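{- For every countable ordinal $\alpha$ and all $x,y\in X^{\alpha}$: $x \mathrel{K_2^{\alpha}} y$ if and only if $x\,\Delta^{\alpha}\,y\in\mathrm{F}^{\alpha}$.
   Context: For each countable limit ordinal $\lambda$ fix an increasing cofinal $\pi_\lambda\colon\omega\to\lambda$; for successor $\alpha+1$ let $\pi_{\alpha+1}$ be constantly $\alpha$. For graphs $G_i$ on $X_i$, $(G_i)^{*}$ is the graph on $\prod_iX_i$ with $x\mathrel{(G_i)^{*}}y$ iff $\exists n\,\forall m>n\;x(m)\mathrel{G_m}y(m)$. For a graph $G$, $G^0=G$ and $G^\alpha=(G^{\pi_\alpha(n)})^{*}_{n\in\omega}$ for $\alpha>0$. $K_2$ is the complete graph on $\{0,1\}$. Let $X^0=\{0,1\}$ and $X^\alpha=\prod_n X^{\pi_\alpha(n)}$ for $\alpha>0$, so $K_2^\alpha$ is a graph on $X^\alpha$. Iterated Fréchet filters and ideals: $\mathrm{F}^0=\{1\}$, $\mathrm{I}^0=\{0\}$, and for $\alpha>0$, $\mathrm{F}^\alpha=\{x\in X^\alpha:\exists n\,\forall m>n\; x(m)\in\mathrm{F}^{\pi_\alpha(m)}\}$, $\mathrm{I}^\alpha=\{x\in X^\alpha:\exists n\,\forall m>n\; x(m)\in\mathrm{I}^{\pi_\alpha(m)}\}$. The operation $\Delta^\alpha$ on $X^\alpha$: $x\,\Delta^0\,y=0$ if $x=y$ and $=1$ otherwise; for $\alpha>0$, $(x\,\Delta^\alpha\,y)(n)=x(n)\,\Delta^{\pi_\alpha(n)}\,y(n)$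 (equivalently, coordinatewise symmetric difference after identifying $X^\alpha$ with $2^\omega$ by reindexing). -}

module Defs where

open import Data.Nat using (ℕ; _<_)
open import Data.Bool using (Bool; true; false; not)
open import Data.Bool.Properties using () renaming (_≟_ to _≟B_)
open import Data.Product using (∃-syntax)
open import Relation.Nullary using (does; ¬_)
open import Relation.Binary.PropositionalEquality using (_≡_)

-- Countable ordinals as Brouwer trees. A tree simultaneously encodes an
-- ordinal and the fixed fundamental sequences π:
--   π_{suc a}(n) = a  (constant),   π_{lim f}(n) = f n.
data Ord : Set where
  zer : Ord
  suc : Ord → Ord
  lim : (ℕ → Ord) → Ord

-- π_α for α > 0 (recursive definitions below inline π_{suc a} n = a, π_{lim f} n = f n)
π : Ord → ℕ → Ord
π zer     _ = zer   -- unused (α = 0 is never expanded)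
π (suc a) _ = a
π (lim f) n = f n

Star : {I : ℕ → Set} → ((n : ℕ) → I n → I n → Set)
     → ((n : ℕ) → I n) → ((n : ℕ) → I n) → Set
Star G x y = ∃[ n ] (∀ m → n < m → G m (x m) (y m))

Vert : Set → Ord → Set
Vert A zer     = A
Vert A (suc a) = (n : ℕ) → Vert A a
Vert A (lim f) = (n : ℕ) → Vert A (f n)

GPow : {A : Set} → (A → A → Set) → (α : Ord) → Vert A α → Vert A α → Set
GPow G zer     = G
GPow G (suc a) = Star (λ n → GPow G a)
GPow G (lim f) = Star (λ n → GPow G (f n))

-- X^0 = {0,1} (0 = false, 1 = true), X^α = ∏_n X^{π_α(n)}
X : Ord → Set
X = Vert Bool

K₂ : Bool → Bool → Set
K₂ x y = ¬ (x ≡ y)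

K₂^ : (α : Ord) → X α → X α → Set
K₂^ = GPow K₂

F : (α : Ord) → X α → Set
F zer     x = x ≡ true
F (suc a) x = ∃[ n ] (∀ m → n < m → F a (x m))
F (lim f) x = ∃[ n ] (∀ m → n < m → F (f m) (x m))

Δ : (α : Ord) → X α → X α → X α
Δ zer     x y   = not (does (x ≟B y))
Δ (suc a) x y n = Δ a (x n) (y n)
Δ (lim f) x y n = Δ (f n) (x n) (y n)

module Submission where

open import Defs
open import Data.Bool using (true; not)
open import Data.Bool.Properties using () renaming (_≟_ to _≟B_)
open import Data.Empty using (⊥-elim)
open import Data.Nat using (ℕ; _<_)
open import Data.Product using (∃-syntax; _,_)
open import Function.Bundles using (_⇔_; mk⇔; Equivalence)
open import Relation.Nullary using (Dec; yes; no; does; ¬_)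
open import Relation.Binary.PropositionalEquality using (_≡_; refl)

-- Both K₂^α and F^α ∘ Δ^α unfold at every nonzero level to the same
-- "for all sufficiently large m" quantifier applied coordinatewise, so the
-- equivalence propagates from level 0 by induction on the Brouwer tree.

¬⇔not-does : ∀ {p} {P : Set p} (P? : Dec P) → (¬ P) ⇔ (not (does P?) ≡ true)
¬⇔not-does (yes p) = mk⇔ (λ ¬p → ⊥-elim (¬p p)) (λ ())
¬⇔not-does (no ¬p) = mk⇔ (λ _ → refl) (λ _ → ¬p)

eventually-cong : {P Q : ℕ → Set} → (∀ m → P m ⇔ Q m) →
                  (∃[ n ] ∀ m → n < m → P m) ⇔ (∃[ n ] ∀ m → n < m → Q m)
eventually-cong P⇔Q = mk⇔
  (λ (n , P>n) → n , λ m n<m → Equivalence.to   (P⇔Q m) (P>n m n<m))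
  (λ (n , Q>n) → n , λ m n<m → Equivalence.from (P⇔Q m) (Q>n m n<m))

lemma3p6 : (α : Ord) (x y : X α) → K₂^ α x y ⇔ F α (Δ α x y)
lemma3p6 zer     x y = ¬⇔not-does (x ≟B y)
lemma3p6 (suc a) x y = eventually-cong λ m → lemma3p6 a (x m) (y m)
lemma3p6 (lim f) x y = eventually-cong λ m → lemma3p6 (f m) (x m) (y m)
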